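{- Let $G \cong K_n$ be the complete graph on $n \ge 1$ vertices. Then $G$ is gap-vertex-labelable if and only if $n \le 3$.
   Context: For $k \in \mathbb{N}$ and $[k] = \{1, \ldots, k\}$, a gap-$[k]$-vertex-labelling of a connected graph $G$ is a pair $(\pi, c_\pi)$ where $\pi : V(G) \to [k]$ and $c_\pi : V(G) \to \{0, 1, \ldots, k\}$ is a proper vertex colouring of $G$ such that for every $v \in V(G)$: if $d(v) \ge 2$ then $c_\pi(v) = \max_{u \in N(v)} \pi(u) - \min_{u \in N(v)} \pi(u)$, and if $d(v) = 1$ then $c_\pi(v) = \pi(u)$ where $u$ is the unique neighbour of $v$. $G$ is gap-vertex-labelable if it admits a gap-$[k]$-vertex-labelling for some $k \in \mathbb{N}$ (the single-vertex graph $K_1$ is considered trivially gap-vertex-labelable). -}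

module Defs where

open import Data.Nat using (ℕ; _≤_; _∸_; _⊔_; _⊓_)
open import Data.Fin using (Fin; _≟_)
open import Data.List using (List; []; _∷_; filter; map; foldr; length)
open import Data.List.Base using (allFin)
open import Data.Bool using (Bool; true; false; not; T)
open import Data.Unit using (⊤)
open import Data.Product using (Σ; _×_; ∃-syntax)
open import Relation.Nullary using (¬_; ⌊_⌋)
open import Relation.Nullary.Decidable using (does)
open import Relation.Binary.PropositionalEquality using (_≡_)

record Graph (n : ℕ) : Set where
  field
    adj     : Fin n → Fin n → Bool
    adj-sym : ∀ u v → adj u v ≡ adj v u
    irrefl  : ∀ v → adj v v ≡ false
open Graph public

N : ∀ {n} → Graph n → Fin n → List (Fin n)
N G v = filter (λ u → T? (adj G v u)) (allFin _)
  where
  open import Data.Bool.Properties using (T?)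

deg : ∀ {n} → Graph n → Fin n → ℕ
deg G v = length (N G v)

maxL : ℕ → List ℕ → ℕ
maxL x xs = foldr _⊔_ x xs

minL : ℕ → List ℕ → ℕ
minL x xs = foldr _⊓_ x xs

gapCond : ∀ {n} → (Fin n → ℕ) → ℕ → List (Fin n) → Set
gapCond π cv []           = ⊤
gapCond π cv (u ∷ [])     = cv ≡ π u
gapCond π cv (u ∷ w ∷ us) =
  cv ≡ maxL (π u) (map π (w ∷ us)) ∸ minL (π u) (map π (w ∷ us))

record GapLabelling {n} (G : Graph n) (k : ℕ) : Set where
  field
    π       : Fin n → ℕ
    c       : Fin n → ℕ
    π-range : ∀ v → 1 ≤ π v × π v ≤ k
    c-range : ∀ v → c v ≤ k
    proper  : ∀ u v → adj G u v ≡ true → ¬ (c u ≡ c v)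
    gap     : ∀ v → gapCond π (c v) (N G v)

GapVertexLabelable : ∀ {n} → Graph n → Set
GapVertexLabelable G = ∃[ k ] GapLabelling G k

K : (n : ℕ) → Graph n
K n = record
  { adj    = λ u v → not (does (u ≟ v))
  ; adj-sym = λ u v → symNot u v
  ; irrefl = λ v → irr v
  }
  where
  open import Relation.Nullary using (yes; no)
  open import Relation.Binary.PropositionalEquality using (refl; sym)
  open import Data.Empty using (⊥-elim)
  symNot : (u v : Fin n) → not (does (u ≟ v)) ≡ not (does (v ≟ u))
  symNot u v with u ≟ v | v ≟ u
  ... | yes _ | yes _ = refl
  ... | no _  | no _  = refl
  ... | yes p | no q  = ⊥-elim (q (sym p))
  ... | no p  | yes q = ⊥-elim (p (sym q))
  irr : (v : Fin n) → not (does (v ≟ v)) ≡ false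
  irr v with v ≟ v
  ... | yes _ = refl
  ... | no p  = ⊥-elim (p refl)

-- For n ≥ 4 pick u maximising and w minimising π, and two further vertices
-- x, y different from u and w: both see u and w among their at least two neighbours, so both are
-- coloured π(u) − π(w), although x and y are adjacent. For n ≤ 3 explicit labellings exist.
module Submission where

open import Defs
open import Data.Nat using (ℕ; _≤_)
open import Function.Bundles using (_⇔_)

open import Data.Nat using (zero; suc; _+_; _∸_; z≤n; s≤s; _≤?_)
open import Data.Nat.Properties
  using (≤-refl; ≤-trans; ≤-antisym; ⊔-lub; m≤m⊔n; m≤n⊔m; ⊓-glb; m⊓n≤m; m⊓n≤n)
  renaming (_≟_ to _≟ℕ_)
open import Data.Fin using (Fin; zero; suc; _≟_; punchIn; punchOut)
open import Data.Fin.Properties using (all?; 0≢1+n; punchInᵢ≢i; punchIn-injective; punchIn-punchOut)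
open import Data.Vec using (_∷_; []; lookup)
open import Data.List using (List; []; _∷_; allFin)
open import Data.List.Membership.Propositional using (_∈_)
open import Data.List.Membership.Propositional.Properties using (∈-filter⁺; ∈-allFin; ∈-map⁺)
open import Data.List.Relation.Unary.All as All using (All; []; _∷_)
open import Data.List.Relation.Unary.All.Properties using (map⁺)
open import Data.List.Relation.Unary.Any.Properties using (singleton⁻)
open import Data.List.Extrema.Nat using (argmax; argmin; f[xs]≤f[argmax]; f[argmin]≤f[xs])
open import Data.Bool using (true)
open import Data.Bool.Properties using (T?; T-≡) renaming (_≟_ to _≟𝔹_)
open import Data.Unit using (tt)
open import Data.Product using (_×_; _,_; proj₁; ∃-syntax; Σ-syntax)
open import Data.Empty using (⊥; ⊥-elim)
open import Function using (_∘_; Injective)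
open import Function.Bundles using (mk⇔; Equivalence)
open import Relation.Nullary using (¬_; yes; no; Dec; contradiction)
open import Relation.Nullary.Decidable using (_×-dec_; _→-dec_; ¬?; from-yes)
open import Relation.Binary.PropositionalEquality using (_≡_; _≢_; refl; sym; trans; cong₂)

maxL-upper : ∀ x xs → All (_≤ maxL x xs) (x ∷ xs)
maxL-upper x []       = ≤-refl ∷ []
maxL-upper x (y ∷ ys) with x≤ ∷ ys≤ ← All.map (λ p → ≤-trans p (m≤n⊔m y _)) (maxL-upper x ys)
  = x≤ ∷ m≤m⊔n y _ ∷ ys≤

maxL-lub : ∀ {m x xs} → All (_≤ m) (x ∷ xs) → maxL x xs ≤ m
maxL-lub (x≤ ∷ [])        = x≤
maxL-lub (x≤ ∷ y≤ ∷ ys≤) = ⊔-lub y≤ (maxL-lub (x≤ ∷ ys≤))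

maxL-attained : ∀ {m x xs} → m ∈ x ∷ xs → All (_≤ m) (x ∷ xs) → maxL x xs ≡ m
maxL-attained {x = x} {xs} m∈ ≤m = ≤-antisym (maxL-lub ≤m) (All.lookup (maxL-upper x xs) m∈)

minL-lower : ∀ x xs → All (minL x xs ≤_) (x ∷ xs)
minL-lower x []       = ≤-refl ∷ []
minL-lower x (y ∷ ys) with ≤x ∷ ≤ys ← All.map (≤-trans (m⊓n≤n y _)) (minL-lower x ys)
  = ≤x ∷ m⊓n≤m y _ ∷ ≤ys

minL-glb : ∀ {m x xs} → All (m ≤_) (x ∷ xs) → m ≤ minL x xs
minL-glb (≤x ∷ [])        = ≤x
minL-glb (≤x ∷ ≤y ∷ ≤ys) = ⊓-glb ≤y (minL-glb (≤x ∷ ≤ys))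

minL-attained : ∀ {m x xs} → m ∈ x ∷ xs → All (m ≤_) (x ∷ xs) → minL x xs ≡ m
minL-attained {x = x} {xs} m∈ m≤ = ≤-antisym (All.lookup (minL-lower x xs) m∈) (minL-glb m≤)

gapCond-extremes : ∀ {n} (π : Fin n → ℕ) {cv} {a b u w : Fin n} {L : List (Fin n)} →
  a ≢ b → a ∈ L → b ∈ L → u ∈ L → w ∈ L →
  All (λ x → π x ≤ π u) L → All (λ x → π w ≤ π x) L → gapCond π cv L → cv ≡ π u ∸ π w
gapCond-extremes π {L = []} _ () _ _ _ _ _ _
gapCond-extremes π {L = _ ∷ []} a≢b a∈ b∈ _ _ _ _ _ =
  contradiction (trans (singleton⁻ a∈) (sym (singleton⁻ b∈))) a≢b
gapCond-extremes π {L = _ ∷ _ ∷ _} _ _ _ u∈ w∈ ≤πu πw≤ gap =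
  trans gap (cong₂ _∸_ (maxL-attained (∈-map⁺ π u∈) (map⁺ ≤πu))
                       (minL-attained (∈-map⁺ π w∈) (map⁺ πw≤)))

∃-argmax : ∀ {n} (f : Fin (suc n) → ℕ) → ∃[ u ] (∀ v → f v ≤ f u)
∃-argmax f = argmax f zero (allFin _) ,
  λ v → All.lookup (f[xs]≤f[argmax] {f = f} zero (allFin _)) (∈-allFin v)

∃-argmin : ∀ {n} (f : Fin (suc n) → ℕ) → ∃[ w ] (∀ v → f w ≤ f v)
∃-argmin f = argmin f zero (allFin _) ,
  λ v → All.lookup (f[argmin]≤f[xs] {f = f} zero (allFin _)) (∈-allFin v)

avoiding : ∀ {n} (u w : Fin (suc (suc n))) →
  Σ[ f ∈ (Fin n → Fin (suc (suc n))) ] Injective _≡_ _≡_ f × (∀ i → f i ≢ u × f i ≢ w)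
avoiding {n} u w with u ≟ w
... | yes refl = punchIn u ∘ punchIn zero
               , punchIn-injective zero _ _ ∘ punchIn-injective u _ _
               , λ i → punchInᵢ≢i u _ , punchInᵢ≢i u _
... | no u≢w   = punchIn u ∘ punchIn w′
               , punchIn-injective w′ _ _ ∘ punchIn-injective u _ _
               , λ i → punchInᵢ≢i u _ , punchInᵢ≢i w′ i ∘ punchIn-injective u _ _ ∘ hits-w
  where
  w′ : Fin (suc n)
  w′ = punchOut u≢w
  hits-w : ∀ {x} → punchIn u x ≡ w → punchIn u x ≡ punchIn u w′
  hits-w eq = trans eq (sym (punchIn-punchOut u≢w))

adj-K : ∀ {n} {u v : Fin n} → u ≢ v → adj (K n) u v ≡ true
adj-K {u = u} {v} u≢v with u ≟ v
... | yes u≡v = contradiction u≡v u≢v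
... | no _    = refl

∈-N-K : ∀ {n} {v u : Fin n} → v ≢ u → u ∈ N (K n) v
∈-N-K {n} {v} {u} v≢u =
  ∈-filter⁺ (T? ∘ adj (K n) v) (∈-allFin u) (Equivalence.from T-≡ (adj-K v≢u))

module _ {n k} (L : GapLabelling (K n) k) where
  open GapLabelling L

  colour-avoiding-extremes : ∀ {u w x y} → (∀ v → π v ≤ π u) → (∀ v → π w ≤ π v) →
    x ≢ y → y ≢ u → x ≢ u × x ≢ w → c x ≡ π u ∸ π w
  colour-avoiding-extremes {x = x} ≤πu πw≤ x≢y y≢u (x≢u , x≢w) =
    gapCond-extremes π y≢u (∈-N-K x≢y) (∈-N-K x≢u) (∈-N-K x≢u) (∈-N-K x≢w)
      (All.tabulate λ {v} _ → ≤πu v) (All.tabulate λ {v} _ → πw≤ v) (gap x)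

  vertices-avoiding-extremes-clash : ∀ {u w x y} → (∀ v → π v ≤ π u) → (∀ v → π w ≤ π v) →
    x ≢ y → x ≢ u × x ≢ w → y ≢ u × y ≢ w → ⊥
  vertices-avoiding-extremes-clash ≤πu πw≤ x≢y x-avoids y-avoids =
    proper _ _ (adj-K x≢y)
      (trans (colour-avoiding-extremes ≤πu πw≤ x≢y (proj₁ y-avoids) x-avoids)
             (sym (colour-avoiding-extremes ≤πu πw≤ (x≢y ∘ sym) (proj₁ x-avoids) y-avoids)))

K≥4-¬gapVertexLabelable : ∀ m → ¬ GapVertexLabelable (K (4 + m))
K≥4-¬gapVertexLabelable m (k , L) =
  let (u , ≤πu) = ∃-argmax (GapLabelling.π L)
      (w , πw≤) = ∃-argmin (GapLabelling.π L)
      (f , f-injective , avoids) = avoiding u w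
  in vertices-avoiding-extremes-clash L ≤πu πw≤ (0≢1+n ∘ f-injective)
       (avoids zero) (avoids (suc zero))

GapLabellingConditions : ∀ {n} → Graph n → ℕ → (π c : Fin n → ℕ) → Set
GapLabellingConditions G k π c =
  (∀ v → 1 ≤ π v × π v ≤ k) × (∀ v → c v ≤ k) ×
  (∀ u v → adj G u v ≡ true → c u ≢ c v) × (∀ v → gapCond π (c v) (N G v))

gapCond? : ∀ {n} (π : Fin n → ℕ) cv (L : List (Fin n)) → Dec (gapCond π cv L)
gapCond? π cv []          = yes tt
gapCond? π cv (u ∷ [])    = cv ≟ℕ π u
gapCond? π cv (_ ∷ _ ∷ _) = cv ≟ℕ _

gapLabellingConditions? : ∀ {n} (G : Graph n) k (π c : Fin n → ℕ) →
  Dec (GapLabellingConditions G k π c)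
gapLabellingConditions? G k π c =
  all? (λ v → (1 ≤? π v) ×-dec (π v ≤? k)) ×-dec
  all? (λ v → c v ≤? k) ×-dec
  all? (λ u → all? λ v → (adj G u v ≟𝔹 true) →-dec ¬? (c u ≟ℕ c v)) ×-dec
  all? (λ v → gapCond? π (c v) (N G v))

gapLabelling : ∀ {n} {G : Graph n} {k π c} → GapLabellingConditions G k π c → GapLabelling G k
gapLabelling {π = π} {c} (π-range , c-range , proper , gap) =
  record { π = π ; c = c ; π-range = π-range ; c-range = c-range ; proper = proper ; gap = gap }

K₁-gapVertexLabelable : GapVertexLabelable (K 1)
K₁-gapVertexLabelable =
  1 , gapLabelling (from-yes (gapLabellingConditions? (K 1) 1 (lookup (1 ∷ [])) (lookup (0 ∷ []))))

K₂-gapVertexLabelable : GapVertexLabelable (K 2)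
K₂-gapVertexLabelable =
  2 , gapLabelling (from-yes (gapLabellingConditions? (K 2) 2 (lookup (1 ∷ 2 ∷ [])) (lookup (2 ∷ 1 ∷ []))))

K₃-gapVertexLabelable : GapVertexLabelable (K 3)
K₃-gapVertexLabelable =
  4 , gapLabelling (from-yes (gapLabellingConditions? (K 3) 4 (lookup (1 ∷ 2 ∷ 4 ∷ [])) (lookup (2 ∷ 3 ∷ 1 ∷ []))))

theorem4 : ∀ (n : ℕ) → 1 ≤ n → (GapVertexLabelable (K n) ⇔ n ≤ 3)
theorem4 1 _ = mk⇔ (λ _ → s≤s z≤n) (λ _ → K₁-gapVertexLabelable)
theorem4 2 _ = mk⇔ (λ _ → s≤s (s≤s z≤n)) (λ _ → K₂-gapVertexLabelable)
theorem4 3 _ = mk⇔ (λ _ → ≤-refl) (λ _ → K₃-gapVertexLabelable)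
theorem4 (suc (suc (suc (suc m)))) _ =
  mk⇔ (⊥-elim ∘ K≥4-¬gapVertexLabelable m) (λ { (s≤s (s≤s (s≤s ()))) })
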